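{- Every graph in the class $\mathcal{F}$ is a $\{\ulcorner\urcorner\}$-EPG graph.
   Context: MAX-3-SAT(3) instances: a set of variables $x_1,\dots,x_{n_{var}}$ and clauses $C_1,\dots,C_{m_{cl}}$, each clause of the form $l^j_1\vee l^j_2\vee l^j_3$ where each literal $l^j_t$ is $x_i$ or $not(x_i)$ for some $i$; each variable appears at most three times, and more precisely for every $i$ the positive literal $x_i$ appears exactly twice and the negative literal $not(x_i)$ appears exactly once. For such an instance, the graph $f(I_{sat})$ has, for each clause $C_j$, three vertices $v^j_1,v^j_2,v^j_3$ forming a triangle ($v^j_t$ corresponds to the literal $l^j_t$), and in addition an edge $\{v^j_t,v^{j'}_{t'}\}$ whenever there is an $i$ such that $l^j_t=x_i$ and $l^{j'}_{t'}=not(x_i)$. $\mathcal{F}$ is the set of all graphs $f(I_{sat})$ for $I_{sat}$ a MAX-3-SAT(3) instance. An EPG representation of a graph $G=(V,E)$ consists of a rectangular grid and a family of simple paths $\{P_v : v\in V\}$ in the grid such that $\{u,v\}\in E$ iff $P_u$ and $P_v$ share at least one grid edge (crossing at a grid vertex does not create an edge). $\{\ulcorner\urcorner\}$-EPG is the class of graphs having such a representation where every path has at most one bend and shape $\ulcorner$ (horizontal part going right and vertical part going down from the corner) or $\urcorner$ (horizontal part going left and vertical part going down from the corner). -}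

module Defs where

open import Data.Nat using (ℕ; zero; suc; _+_; _≤_; _<_)
open import Data.Nat.Properties using () renaming (_≟_ to _≟ℕ_)
open import Data.Fin using (Fin)
open import Data.Fin.Properties using () renaming (_≟_ to _≟F_)
open import Data.Bool using (Bool; true; false)
open import Data.Bool.Properties using () renaming (_≟_ to _≟B_)
open import Data.List using (List; allFin; length; filter; cartesianProduct)
open import Data.Product using (Σ; ∃; _×_; _,_; proj₁; proj₂)
open import Data.Product.Properties using (≡-dec)
open import Data.Sum using (_⊎_)
open import Relation.Binary.PropositionalEquality using (_≡_; _≢_)
open import Function.Bundles using (_⇔_)

-- A literal over n variables: (i , true) is x_i, (i , false) is not(x_i).
Lit : ℕ → Set
Lit n = Fin n × Bool

Pos : ℕ → Set
Pos m = Fin m × Fin 3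

positions : (m : ℕ) → List (Pos m)
positions m = cartesianProduct (allFin m) (allFin 3)

record Instance : Set where
  field
    nvar : ℕ
    ncl  : ℕ
    lit  : Pos ncl → Lit nvar

  occurrences : Lit nvar → ℕ
  occurrences ℓ =
    length (filter (λ p → ≡-dec _≟F_ _≟B_ (lit p) ℓ) (positions ncl))

IsMax3Sat3 : Instance → Set
IsMax3Sat3 I = ∀ i → (occurrences (i , true) ≡ 2) × (occurrences (i , false) ≡ 1)
  where open Instance I

fAdj : (I : Instance) → Pos (Instance.ncl I) → Pos (Instance.ncl I) → Set
fAdj I u v =
  (u ≢ v × proj₁ u ≡ proj₁ v)
  ⊎ (∃ λ i → (lit u ≡ (i , true) × lit v ≡ (i , false))
              ⊎ (lit u ≡ (i , false) × lit v ≡ (i , true)))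
  where open Instance I

-- Grid, single-bend paths of shape ⌜ and ⌝, EPG representations.
-- Grid points are (x , y) ∈ ℕ × ℕ; x grows to the right, y grows downwards.

-- horiz x y : edge between (x , y) and (x+1 , y)
-- vert  x y : edge between (x , y) and (x , y+1)
data GridEdge : Set where
  horiz : ℕ → ℕ → GridEdge
  vert  : ℕ → ℕ → GridEdge

data Shape : Set where
  ⌜ : Shape   -- horizontal part going right, vertical part going down
  ⌝ : Shape   -- horizontal part going left, vertical part going down

-- A path with at most one bend: corner (cx , cy), horizontal arm of length
-- hlen, vertical arm of length vlen (an arm of length 0 means no bend).
record BendPath : Set where
  constructor mkPath
  field
    shape : Shape
    cx cy hlen vlen : ℕ

data OnPath : BendPath → GridEdge → Set where
  h⌜ : ∀ {cx cy hl vl u} → cx ≤ u → u < cx + hl →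
       OnPath (mkPath ⌜ cx cy hl vl) (horiz u cy)
  h⌝ : ∀ {cx cy hl vl u} → u < cx → cx ≤ u + hl →
       OnPath (mkPath ⌝ cx cy hl vl) (horiz u cy)
  v↓ : ∀ {s cx cy hl vl w} → cy ≤ w → w < cy + vl →
       OnPath (mkPath s cx cy hl vl) (vert cx w)

-- the path is a genuine path (at least one edge) lying in the
-- rectangular grid [0,W] × [0,H]
InGrid : ℕ → ℕ → BendPath → Set
InGrid W H (mkPath ⌜ cx cy hl vl) = (1 ≤ hl + vl) × (cx + hl ≤ W) × (cy + vl ≤ H)
InGrid W H (mkPath ⌝ cx cy hl vl) = (1 ≤ hl + vl) × (hl ≤ cx) × (cx ≤ W) × (cy + vl ≤ H)

ShareEdge : BendPath → BendPath → Set
ShareEdge P Q = ∃ λ e → OnPath P e × OnPath Q e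

Is⌜⌝EPG : (V : Set) → (V → V → Set) → Set
Is⌜⌝EPG V Adj =
  Σ ℕ λ W → Σ ℕ λ H → Σ (V → BendPath) λ P →
    (∀ v → InGrid W H (P v)) ×
    (∀ u v → u ≢ v → Adj u v ⇔ ShareEdge (P u) (P v))

module Submission where

-- The grid has one column per clause and one row per variable,
-- plus a bottom row.  The path of a literal l^j_t of variable x_i has its
-- corner at (column j , row i) and its vertical arm runs down to the
-- bottom of the grid, so two paths share a vertical edge exactly when
-- they belong to the same clause (they all use the bottom edge of their
-- column).  Horizontal arms stay in the row of their variable, so only
-- the three occurrences of x_i compete there.  Let a be the column of the
-- unique occurrence of not(x_i).  If some positive occurrence lies right
-- of a, the negative arm ⌜ runs from a to the right border and each
-- positive arm ⌜ at c runs up to and including column max(a , c);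
-- otherwise the negative arm ⌝ runs from a to the left border and each
-- positive arm has length one.  Either way the negative arm meets every
-- positive arm of another clause, while positive arms of two different
-- clauses could only meet if both started at or left of column a, which
-- together with the positive occurrence right of a would make three
-- positive occurrences of x_i.

open import Defs
open import Data.Nat using (ℕ; suc; _+_; _∸_; _⊔_; _≤_; _<_; z≤n; s≤s; _≟_; _<?_)
open import Data.Nat.Properties
open import Data.Fin using (Fin; toℕ)
open import Data.Fin.Properties using (toℕ-injective; toℕ<n; any?) renaming (_≟_ to _≟F_)
open import Data.Bool using (Bool; true; false; T; not)
open import Data.Bool.Properties using () renaming (_≟_ to _≟B_)
open import Data.List using (List; _∷_; length; filter)
open import Data.List.Membership.Propositional using (_∈_)
open import Data.List.Membership.Propositional.Properties
  using (∈-filter⁺; ∈-filter⁻; ∈-cartesianProduct⁺; ∈-allFin)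
open import Data.List.Relation.Unary.Any using (here; there)
open import Data.Product using (∃; _×_; _,_; proj₁; proj₂)
open import Data.Product.Properties using (≡-dec)
open import Data.Sum using (_⊎_; inj₁; inj₂)
open import Data.Empty using (⊥; ⊥-elim)
open import Data.Unit using (tt)
open import Relation.Nullary using (Dec; yes; no)
open import Relation.Nullary.Decidable using (map′; _×-dec_; isYes; toWitness; toWitnessFalse)
open import Relation.Unary using (Decidable)
open import Relation.Binary.PropositionalEquality
open import Function.Base using (_∘_)
open import Function.Bundles using (mk⇔)

-- Lower bounds on the length of a list from distinct members; they turn the
-- occurrence counts of MAX-3-SAT(3) into uniqueness statements.
module _ {A : Set} where

  member-of-nonempty : {xs : List A} → 1 ≤ length xs → ∃ λ x → x ∈ xs
  member-of-nonempty {x ∷ _} _ = x , here refl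

  member⇒1≤length : {x : A} {xs : List A} → x ∈ xs → 1 ≤ length xs
  member⇒1≤length (here _)  = s≤s z≤n
  member⇒1≤length (there _) = s≤s z≤n

  two-members⇒2≤length : {x y : A} {xs : List A} →
    x ∈ xs → y ∈ xs → x ≢ y → 2 ≤ length xs
  two-members⇒2≤length (here refl) (here refl) x≢y = ⊥-elim (x≢y refl)
  two-members⇒2≤length (here refl) (there y∈) _    = s≤s (member⇒1≤length y∈)
  two-members⇒2≤length (there x∈) (here refl) _    = s≤s (member⇒1≤length x∈)
  two-members⇒2≤length (there x∈) (there y∈) x≢y  =
    m≤n⇒m≤1+n (two-members⇒2≤length x∈ y∈ x≢y)

  three-members⇒3≤length : {x y z : A} {xs : List A} →
    x ∈ xs → y ∈ xs → z ∈ xs → x ≢ y → x ≢ z → y ≢ z → 3 ≤ length xs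
  three-members⇒3≤length (here refl) (here refl) _ x≢y _ _ = ⊥-elim (x≢y refl)
  three-members⇒3≤length (here refl) _ (here refl) _ x≢z _ = ⊥-elim (x≢z refl)
  three-members⇒3≤length _ (here refl) (here refl) _ _ y≢z = ⊥-elim (y≢z refl)
  three-members⇒3≤length (here refl) (there y∈) (there z∈) _ _ y≢z =
    s≤s (two-members⇒2≤length y∈ z∈ y≢z)
  three-members⇒3≤length (there x∈) (here refl) (there z∈) _ x≢z _ =
    s≤s (two-members⇒2≤length x∈ z∈ x≢z)
  three-members⇒3≤length (there x∈) (there y∈) (here refl) x≢y _ _ =
    s≤s (two-members⇒2≤length x∈ y∈ x≢y)
  three-members⇒3≤length (there x∈) (there y∈) (there z∈) x≢y x≢z y≢z =
    m≤n⇒m≤1+n (three-members⇒3≤length x∈ y∈ z∈ x≢y x≢z y≢z)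

vertical-in-corner-column : ∀ {s cx cy hl vl x w} →
  OnPath (mkPath s cx cy hl vl) (vert x w) → x ≡ cx
vertical-in-corner-column (v↓ _ _) = refl

horizontal-in-corner-row : ∀ {s cx cy hl vl x y} →
  OnPath (mkPath s cx cy hl vl) (horiz x y) → y ≡ cy
horizontal-in-corner-row (h⌜ _ _) = refl
horizontal-in-corner-row (h⌝ _ _) = refl

-- Length of a vertical arm starting in row r that ends in row suc D.
armDepth : ℕ → ℕ → ℕ
armDepth D r = suc (D ∸ r)

armDepth-reaches-bottom : ∀ {D r} → r ≤ D → r + armDepth D r ≡ suc D
armDepth-reaches-bottom {D} {r} r≤D = trans (+-suc r (D ∸ r)) (cong suc (m+[n∸m]≡n r≤D))

-- Every arm of depth armDepth D r uses the lowest edge of its column, so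
-- paths with corners in the same column share an edge.
bottom-edge : ∀ {s c r hl D} → r ≤ D → OnPath (mkPath s c r hl (armDepth D r)) (vert c D)
bottom-edge r≤D = v↓ r≤D (≤-reflexive (sym (armDepth-reaches-bottom r≤D)))

arm-nonempty : ∀ hl D r → 1 ≤ hl + armDepth D r
arm-nonempty hl D r = ≤-trans (s≤s z≤n) (m≤n+m (armDepth D r) hl)

negShape : Bool → Shape
negShape true  = ⌜
negShape false = ⌝

negArm : ℕ → Bool → ℕ → ℕ
negArm W true  a = W ∸ a
negArm W false a = a

posReach : Bool → ℕ → ℕ → ℕ
posReach true  a c = suc (a ⊔ c)
posReach false a c = suc c

posArm : Bool → ℕ → ℕ → ℕ
posArm m a c = posReach m a c ∸ c

posArm-end : ∀ m a c → c + posArm m a c ≡ posReach m a c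
posArm-end true  a c = m+[n∸m]≡n (m≤n⇒m≤1+n (m≤n⊔m a c))
posArm-end false a c = m+[n∸m]≡n (n≤1+n c)

positive-meets-negative : ∀ {W r a c vl vl'} m → a < W → c < W → (m ≡ false → c < a) →
  ShareEdge (mkPath ⌜ c r (posArm m a c) vl) (mkPath (negShape m) a r (negArm W m a) vl')
positive-meets-negative {W} {r} {a} {c} true a<W c<W _ =
  horiz (a ⊔ c) r ,
  h⌜ (m≤n⊔m a c) (≤-reflexive (sym (posArm-end true a c))) ,
  h⌜ (m≤m⊔n a c) (subst (a ⊔ c <_) (sym (m+[n∸m]≡n (<⇒≤ a<W))) (⊔-lub a<W c<W))
positive-meets-negative {W} {r} {a} {c} false _ _ c<a =
  horiz c r ,
  h⌜ ≤-refl (≤-reflexive (sym (posArm-end false a c))) ,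
  h⌝ (c<a refl) (m≤n+m a c)

positive-arm-point : ∀ m a c x → c ≤ x → x < posReach m a c →
  x ≡ c ⊎ (m ≡ true × x ≤ a)
positive-arm-point false a c x c≤x x<1+c = inj₁ (≤-antisym (m<1+n⇒m≤n x<1+c) c≤x)
positive-arm-point true a c x c≤x x<reach with ⊔-sel a c
... | inj₁ a⊔c≡a = inj₂ (refl , subst (x ≤_) a⊔c≡a (m<1+n⇒m≤n x<reach))
... | inj₂ a⊔c≡c = inj₁ (≤-antisym (subst (x ≤_) a⊔c≡c (m<1+n⇒m≤n x<reach)) c≤x)

positive-arms-overlap : ∀ {m a cu cv r vl vl' x y} →
  OnPath (mkPath ⌜ cu r (posArm m a cu) vl) (horiz x y) →
  OnPath (mkPath ⌜ cv r (posArm m a cv) vl') (horiz x y) →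
  cu ≡ cv ⊎ (m ≡ true × cu ≤ a × cv ≤ a)
positive-arms-overlap {m} {a} {cu} {cv} {x = x} (h⌜ cu≤x x<u) (h⌜ cv≤x x<v)
  with positive-arm-point m a cu x cu≤x (subst (x <_) (posArm-end m a cu) x<u)
     | positive-arm-point m a cv x cv≤x (subst (x <_) (posArm-end m a cv) x<v)
... | inj₁ refl | inj₁ refl       = inj₁ refl
... | inj₁ refl | inj₂ (mt , x≤a) = inj₂ (mt , x≤a , ≤-trans cv≤x x≤a)
... | inj₂ (mt , x≤a) | _         = inj₂ (mt , ≤-trans cu≤x x≤a , ≤-trans cv≤x x≤a)

positive-in-grid : ∀ {W D r a c} m → r ≤ D → a < W → c < W →
  InGrid W (suc D) (mkPath ⌜ c r (posArm m a c) (armDepth D r))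
positive-in-grid {W} {D} {r} {a} {c} m r≤D a<W c<W =
  arm-nonempty (posArm m a c) D r ,
  subst (_≤ W) (sym (posArm-end m a c)) (reach≤W m) ,
  ≤-reflexive (armDepth-reaches-bottom r≤D)
  where
    reach≤W : ∀ m → posReach m a c ≤ W
    reach≤W true  = ⊔-lub a<W c<W
    reach≤W false = c<W

negative-in-grid : ∀ {W D r a} m → r ≤ D → a < W →
  InGrid W (suc D) (mkPath (negShape m) a r (negArm W m a) (armDepth D r))
negative-in-grid {W} {D} {r} {a} true r≤D a<W =
  arm-nonempty (W ∸ a) D r ,
  ≤-reflexive (m+[n∸m]≡n (<⇒≤ a<W)) ,
  ≤-reflexive (armDepth-reaches-bottom r≤D)
negative-in-grid {W} {D} {r} {a} false r≤D a<W =
  arm-nonempty a D r , ≤-refl , <⇒≤ a<W , ≤-reflexive (armDepth-reaches-bottom r≤D)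

any-position? : ∀ {m} {P : Pos m → Set} → Decidable P → Dec (∃ P)
any-position? P? =
  map′ (λ { (j , t , p) → (j , t) , p }) (λ { ((j , t) , p) → j , t , p })
       (any? λ j → any? λ t → P? (j , t))

module Layout (I : Instance) (max3sat3 : IsMax3Sat3 I) where
  open Instance I

  _≟L_ : (ℓ ℓ' : Lit nvar) → Dec (ℓ ≡ ℓ')
  _≟L_ = ≡-dec _≟F_ _≟B_

  col : Pos ncl → ℕ
  col (j , _) = toℕ j

  col<ncl : ∀ v → col v < ncl
  col<ncl (j , _) = toℕ<n j

  row : Fin nvar → ℕ
  row = toℕ

  occurrenceList : Lit nvar → List (Pos ncl)
  occurrenceList ℓ = filter (λ p → lit p ≟L ℓ) (positions ncl)

  occurs : ∀ {v ℓ} → lit v ≡ ℓ → v ∈ occurrenceList ℓ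
  occurs {v = j , t} {ℓ} =
    ∈-filter⁺ (λ p → lit p ≟L ℓ) (∈-cartesianProduct⁺ (∈-allFin j) (∈-allFin t))

  negative-unique : ∀ {u v i} → lit u ≡ (i , false) → lit v ≡ (i , false) → u ≡ v
  negative-unique {u} {v} {i} eu ev with ≡-dec _≟F_ _≟F_ u v
  ... | yes u≡v = u≡v
  ... | no u≢v with subst (2 ≤_) (proj₂ (max3sat3 i))
                          (two-members⇒2≤length (occurs eu) (occurs ev) u≢v)
  ...   | s≤s ()

  negative-occurrence : ∀ i → ∃ λ v → lit v ≡ (i , false)
  negative-occurrence i
    with member-of-nonempty {xs = occurrenceList (i , false)} (≤-reflexive (sym (proj₂ (max3sat3 i))))
  ... | v , v∈ = v , proj₂ (∈-filter⁻ (λ p → lit p ≟L (i , false)) {xs = positions ncl} v∈)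

  negCol : Fin nvar → ℕ
  negCol i = col (proj₁ (negative-occurrence i))

  negCol-of : ∀ {v i} → lit v ≡ (i , false) → negCol i ≡ col v
  negCol-of {v} {i} ev =
    cong col (negative-unique (proj₂ (negative-occurrence i)) ev)

  negCol<ncl : ∀ i → negCol i < ncl
  negCol<ncl i = col<ncl (proj₁ (negative-occurrence i))

  no-three-positives : ∀ {u v w i} →
    lit u ≡ (i , true) → lit v ≡ (i , true) → lit w ≡ (i , true) →
    u ≢ v → u ≢ w → v ≢ w → ⊥
  no-three-positives {i = i} eu ev ew u≢v u≢w v≢w
    with subst (3 ≤_) (proj₁ (max3sat3 i))
               (three-members⇒3≤length (occurs eu) (occurs ev) (occurs ew) u≢v u≢w v≢w)
  ... | s≤s (s≤s ())

  RightPositive : Fin nvar → Set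
  RightPositive i = ∃ λ w → lit w ≡ (i , true) × negCol i < col w

  rightPositive? : ∀ i → Dec (RightPositive i)
  rightPositive? i = any-position? (λ w → (lit w ≟L (i , true)) ×-dec (negCol i <? col w))

  pointsRight : Fin nvar → Bool
  pointsRight i = isYes (rightPositive? i)

  right-positive : ∀ {i} → pointsRight i ≡ true → RightPositive i
  right-positive {i} mt = toWitness {a? = rightPositive? i} (subst T (sym mt) tt)

  left-of-negative : ∀ {w i} → pointsRight i ≡ false → lit w ≡ (i , true) → col w ≤ negCol i
  left-of-negative {w} {i} mf ew =
    ≮⇒≥ (λ a<cw → toWitnessFalse {a? = rightPositive? i} (subst (T ∘ not) (sym mf) tt) (w , ew , a<cw))

  literalShape : Fin nvar → Bool → Shape
  literalShape i true  = ⌜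
  literalShape i false = negShape (pointsRight i)

  literalArm : Fin nvar → Bool → ℕ → ℕ
  literalArm i true  c = posArm (pointsRight i) (negCol i) c
  literalArm i false c = negArm ncl (pointsRight i) c

  literalPath : Lit nvar → ℕ → BendPath
  literalPath (i , b) c = mkPath (literalShape i b) c (row i) (literalArm i b c) (armDepth nvar (row i))

  path : Pos ncl → BendPath
  path v = literalPath (lit v) (col v)

  row≤nvar : ∀ i → row i ≤ nvar
  row≤nvar i = <⇒≤ (toℕ<n i)

  literal-in-grid : ∀ ℓ c → c < ncl → InGrid ncl (suc nvar) (literalPath ℓ c)
  literal-in-grid (i , true)  c c<ncl =
    positive-in-grid (pointsRight i) (row≤nvar i) (negCol<ncl i) c<ncl
  literal-in-grid (i , false) c c<ncl = negative-in-grid (pointsRight i) (row≤nvar i) c<ncl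

  same-column-share : ∀ {u v} → col u ≡ col v → ShareEdge (path u) (path v)
  same-column-share {u} {v} cu≡cv =
    vert (col u) nvar ,
    bottom-edge (row≤nvar (proj₁ (lit u))) ,
    subst (λ c → OnPath (path v) (vert c nvar)) (sym cu≡cv) (bottom-edge (row≤nvar (proj₁ (lit v))))

  positive-negative-share : ∀ {u v i} → lit u ≡ (i , true) → lit v ≡ (i , false) →
    ShareEdge (path u) (path v)
  positive-negative-share {u} {v} {i} eu ev with col u ≟ col v
  ... | yes same = same-column-share same
  ... | no  diff = subst₂ ShareEdge (cong (λ ℓ → literalPath ℓ (col u)) (sym eu))
                                    (cong (λ ℓ → literalPath ℓ (col v)) (sym ev)) in-row
    where
      m = pointsRight i
      a≡cv = negCol-of ev
      left-if-false : m ≡ false → col u < negCol i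
      left-if-false mf = ≤∧≢⇒< (left-of-negative mf eu) (λ cu≡a → diff (trans cu≡a a≡cv))
      in-row : ShareEdge (literalPath (i , true) (col u)) (literalPath (i , false) (col v))
      in-row = subst (λ a → ShareEdge (literalPath (i , true) (col u))
                                      (mkPath (negShape m) a (row i) (negArm ncl m a) (armDepth nvar (row i))))
                     a≡cv
                     (positive-meets-negative m (negCol<ncl i) (col<ncl u) left-if-false)

  swap-share : ∀ {P Q} → ShareEdge P Q → ShareEdge Q P
  swap-share (e , onP , onQ) = e , onQ , onP

  adjacent⇒share : ∀ {u v} → fAdj I u v → ShareEdge (path u) (path v)
  adjacent⇒share (inj₁ (_ , same-clause))          = same-column-share (cong toℕ same-clause)
  adjacent⇒share (inj₂ (i , inj₁ (eu , ev))) = positive-negative-share eu ev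
  adjacent⇒share (inj₂ (i , inj₂ (eu , ev))) = swap-share (positive-negative-share ev eu)

  same-row-adjacent : ∀ {u v x y} iu bu iv bv → lit u ≡ (iu , bu) → lit v ≡ (iv , bv) → iu ≡ iv →
    u ≢ v → col u ≢ col v →
    OnPath (literalPath (iu , bu) (col u)) (horiz x y) →
    OnPath (literalPath (iv , bv) (col v)) (horiz x y) → fAdj I u v
  same-row-adjacent i true  .i false eu ev refl _ _ _ _ = inj₂ (i , inj₁ (eu , ev))
  same-row-adjacent i false .i true  eu ev refl _ _ _ _ = inj₂ (i , inj₂ (eu , ev))
  same-row-adjacent i false .i false eu ev refl u≢v _ _ _ = ⊥-elim (u≢v (negative-unique eu ev))
  same-row-adjacent i true  .i true  eu ev refl u≢v cu≢cv onU onV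
    with positive-arms-overlap onU onV
  ... | inj₁ cu≡cv = ⊥-elim (cu≢cv cu≡cv)
  ... | inj₂ (mt , cu≤a , cv≤a) with right-positive mt
  ...   | w , ew , a<cw =
          ⊥-elim (no-three-positives eu ev ew u≢v (differ cu≤a) (differ cv≤a))
    where
      differ : ∀ {p} → col p ≤ negCol i → p ≢ w
      differ cp≤a refl = <⇒≱ a<cw cp≤a

  share⇒adjacent : ∀ {u v} → u ≢ v → ShareEdge (path u) (path v) → fAdj I u v
  share⇒adjacent u≢v (vert x w , onU , onV) =
    inj₁ (u≢v , toℕ-injective (trans (sym (vertical-in-corner-column onU))
                                     (vertical-in-corner-column onV)))
  share⇒adjacent {u} {v} u≢v (horiz x y , onU , onV) with proj₁ u ≟F proj₁ v
  ... | yes same-clause = inj₁ (u≢v , same-clause)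
  ... | no  diff-clause =
    same-row-adjacent (proj₁ (lit u)) (proj₂ (lit u)) (proj₁ (lit v)) (proj₂ (lit v)) refl refl
      (toℕ-injective (trans (sym (horizontal-in-corner-row onU)) (horizontal-in-corner-row onV)))
      u≢v (λ cu≡cv → diff-clause (toℕ-injective cu≡cv)) onU onV

proposition2 : (I : Instance) → IsMax3Sat3 I →
    Is⌜⌝EPG (Pos (Instance.ncl I)) (fAdj I)
proposition2 I max3sat3 =
  ncl , suc nvar , path ,
  (λ v → literal-in-grid (lit v) (col v) (col<ncl v)) ,
  (λ u v u≢v → mk⇔ adjacent⇒share (share⇒adjacent u≢v))
  where
    open Instance I
    open Layout I max3sat3
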